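{- In every chordal $(3,3)$-coloring of $K_n$ there is a strong cover of all vertices, and $\theta(K_n)\le 3$. Moreover, equality can occur for interval colorings: there is an interval $(3,3)$-coloring of $K_9$ with $\theta(K_9)=3$.
   Context: A $t$-coloring of $K_n$ is a representation of its edge set as a union $E(G_1)\cup\dots\cup E(G_t)$ of edge sets of $t$ graphs $G_1,\dots,G_t$ on $V(K_n)$; an edge may receive several colors. A clique of color $i$ is a vertex set spanning a complete subgraph of $G_i$. A $(t,k)$-coloring is a $t$-coloring in which every set of $k$ vertices (the whole vertex set if $n<k$) spans a clique of some color. It is chordal (resp. interval) if every $G_i$ is a chordal graph, i.e. has no induced cycle of length at least $4$ (resp. an interval graph). A strong cover is a covering of all vertices by monochromatic cliques of pairwise different colors; $\theta(K_n)$ is the minimum number of cliques in a strong cover. -}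

module Defs where

open import Data.Nat using (ℕ; zero; suc; _≤_; _<_)
open import Data.Fin using (Fin; toℕ)
open import Data.Fin.Subset using (Subset; _∈_; ∣_∣; ⊤)
open import Data.Bool using (Bool; true; false)
open import Data.Product using (Σ; ∃; ∃-syntax; _×_; _,_)
open import Data.Sum using (_⊎_)
open import Relation.Nullary using (¬_)
open import Relation.Binary.PropositionalEquality using (_≡_; _≢_)
open import Function.Definitions using (Injective)

record Graph (n : ℕ) : Set where
  field
    adj    : Fin n → Fin n → Bool
    sym    : ∀ u v → adj u v ≡ adj v u
    irrefl : ∀ v → adj v v ≡ false
open Graph public

Adj : ∀ {n} → Graph n → Fin n → Fin n → Set
Adj G u v = adj G u v ≡ true

-- A t-coloring of K_n: graphs G_1..G_t on V(K_n) whose edge sets cover E(K_n)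
-- (an edge may receive several colours).
record Coloring (t n : ℕ) : Set where
  field
    graph  : Fin t → Graph n
    covers : ∀ u v → u ≢ v → ∃[ i ] Adj (graph i) u v
open Coloring public

IsClique : ∀ {n} → Graph n → Subset n → Set
IsClique G S = ∀ u v → u ∈ S → v ∈ S → u ≢ v → Adj G u v

IsTK : ∀ {t n} → Coloring t n → ℕ → Set
IsTK {t} {n} c k =
  (∀ (S : Subset n) → ∣ S ∣ ≡ k → ∃[ i ] IsClique (graph c i) S)
  × (n < k → ∃[ i ] IsClique (graph c i) ⊤)

CycAdj : (k : ℕ) → Fin k → Fin k → Set
CycAdj k i j =
  toℕ j ≡ suc (toℕ i) ⊎ toℕ i ≡ suc (toℕ j)
  ⊎ (toℕ i ≡ 0 × suc (toℕ j) ≡ k) ⊎ (toℕ j ≡ 0 × suc (toℕ i) ≡ k)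

InducedCycle : ∀ {n} → Graph n → (k : ℕ) → (Fin k → Fin n) → Set
InducedCycle G k f =
  Injective _≡_ _≡_ f
  × (∀ i j → (Adj G (f i) (f j) → CycAdj k i j) × (CycAdj k i j → Adj G (f i) (f j)))

Chordal : ∀ {n} → Graph n → Set
Chordal G = ∀ k → 4 ≤ k → ∀ f → ¬ InducedCycle G k f

IsInterval : ∀ {n} → Graph n → Set
IsInterval {n} G =
  Σ (Fin n → ℕ) λ l → Σ (Fin n → ℕ) λ r →
    (∀ v → l v ≤ r v)
    × (∀ u v → u ≢ v → (Adj G u v → l u ≤ r v × l v ≤ r u)
                      × (l u ≤ r v × l v ≤ r u → Adj G u v))

record StrongCover {t n : ℕ} (c : Coloring t n) (m : ℕ) : Set where
  field
    colour      : Fin m → Fin t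
    colour-inj  : Injective _≡_ _≡_ colour
    clique      : Fin m → Subset n
    isClique    : ∀ j → IsClique (graph c (colour j)) (clique j)
    coversAll   : ∀ v → ∃[ j ] v ∈ clique j

IsTheta : ∀ {t n} → Coloring t n → ℕ → Set
IsTheta c m = StrongCover c m × (∀ m' → StrongCover c m' → m ≤ m')

-- Only two colours need to be chordal.  Let U be the set of vertices adjacent to all others
-- in colour 2.  If an edge uv of K_n has colour 2 only, then for every third vertex z the
-- monochromatic triangle uvz must have colour 2, so u ∈ U; hence every pair outside U is
-- covered by the colours 0 and 1.  A vertex set whose pairs are covered by two chordal graphs
-- A and B splits into an A-clique K and a B-clique: starting from K = ∅, replace K by
-- {a} ∪ (K ∩ N_A(a)) for a conflicting vertex a whose set of A-non-neighbours in K is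
-- inclusion-minimal; a conflict created by this step would produce an induced C4 in A or B or
-- an induced C5 in A, so the set of conflicting vertices strictly shrinks.  The cliques
-- K, (V ∖ U) ∖ K and U form a strong cover with three colours; θ is then the least of the
-- decidable sizes 0, 1, 2, 3.  The interval colouring of K_9 is verified by exhaustive search.
module Submission where

open import Defs
open import Data.Nat using (ℕ; _≤_)
open import Data.Fin using (Fin)
open import Data.Product using (Σ; _×_)

open import Data.Bool using (true; not; _∧_)
import Data.Bool as Bool
open import Data.Bool.Properties using (∧-comm; T-≡; T-∧)
open import Data.Empty using (⊥; ⊥-elim)
open import Data.Fin as Fin using (toℕ; _≟_)
open import Data.Fin.Patterns using (0F; 1F; 2F; 3F; 4F)
open import Data.Fin.Properties using (all?; any?; ¬Fin0)
open import Data.Fin.Subset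
  using (Subset; _∈_; _∉_; _⊆_; _⊂_; _⊄_; _∪_; _∩_; ∁; ⁅_⁆; ⊤; ∣_∣; inside; outside)
  renaming (⊥ to ∅)
open import Data.Fin.Subset.Properties
  using (_∈?_; _⊂?_; anySubset?; ∈⊤; ∉⊥; x∈⁅x⁆; x∈⁅y⁆⇒x≡y; ∣⁅x⁆∣≡1; ∪-identityˡ;
         x∈p∪q⁺; x∈p∪q⁻; x∈p∩q⁺; x∈p∩q⁻; x∈∁p⇒x∉p; x∉p⇒x∈∁p)
open import Data.Fin.Subset.Induction using (⊂-wellFounded)
open import Data.Nat as ℕ using (zero; suc; _+_; _<_; _≤ᵇ_; z≤n; s≤s)
open import Data.Nat.Properties using (≤-refl; <⇒≤; ≮⇒≥; m≤n+m; +-suc; +-identityʳ; m<1+n⇒m<n∨m≡n; ≤ᵇ⇒≤; ≤⇒≤ᵇ)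
open import Data.Product as Product using (∃; ∃-syntax; _,_; proj₁; proj₂)
open import Data.Sum using (_⊎_; inj₁; inj₂; [_,_]′)
open import Data.Vec using (Vec; _∷_; []; lookup; tabulate; here; there)
open import Data.Vec.Properties using (lookup∘tabulate; lookup⇒[]=; []=⇒lookup)
open import Function using (_∘_; id; const; flip)
open import Function.Bundles using (_⇔_; mk⇔; Equivalence)
open import Function.Definitions using (Injective)
open import Induction.WellFounded using (Acc; acc)
open import Relation.Binary.PropositionalEquality as ≡
  using (_≡_; _≢_; refl; trans; cong; cong₂; subst; ≢-sym)
open import Relation.Nullary using (¬_; Dec; yes; no; does; ¬?; contradiction)
open import Relation.Nullary.Decidable as Dec
  using (True; False; _×-dec_; _⊎-dec_; _→-dec_; map′; fromWitness; fromWitnessFalse; toWitness;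
         dec-true; dec-false; decidable-stable; from-yes; from-no)
open import Relation.Unary using (Decidable)

∈∉⇒≢ : ∀ {n} {p : Subset n} {x y} → x ∈ p → y ∉ p → x ≢ y
∈∉⇒≢ x∈p y∉p refl = y∉p x∈p

adj? : ∀ {n} (G : Graph n) (u v : Fin n) → Dec (Adj G u v)
adj? G u v = adj G u v Bool.≟ true

Adj-sym : ∀ {n} (G : Graph n) {u v} → Adj G u v → Adj G v u
Adj-sym G {u} {v} uv = trans (Graph.sym G v u) uv

¬Adj-sym : ∀ {n} (G : Graph n) {u v} → ¬ Adj G u v → ¬ Adj G v u
¬Adj-sym G ¬uv = ¬uv ∘ Adj-sym G

Adj⇒≢ : ∀ {n} (G : Graph n) {u v} → Adj G u v → u ≢ v
Adj⇒≢ G {u} uu refl with trans (≡.sym (irrefl G u)) uu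
... | ()

Adj-¬Adj⇒≢ : ∀ {n} (G : Graph n) {c x y} → Adj G c x → ¬ Adj G c y → x ≢ y
Adj-¬Adj⇒≢ G cx ¬cy refl = ¬cy cx

clique? : ∀ {n} (G : Graph n) → Decidable (IsClique G)
clique? G S = all? λ u → all? λ v → u ∈? S →-dec v ∈? S →-dec ¬? (u ≟ v) →-dec adj? G u v

Universal : ∀ {n} → Graph n → Fin n → Set
Universal G v = ∀ w → v ≢ w → Adj G v w

universal? : ∀ {n} (G : Graph n) → Decidable (Universal G)
universal? G v = all? λ w → ¬? (v ≟ w) →-dec adj? G v w

cycAdj? : ∀ k (i j : Fin k) → Dec (CycAdj k i j)
cycAdj? k i j =
  toℕ j ℕ.≟ suc (toℕ i) ⊎-dec toℕ i ℕ.≟ suc (toℕ j)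
  ⊎-dec (toℕ i ℕ.≟ 0 ×-dec suc (toℕ j) ℕ.≟ k) ⊎-dec (toℕ j ℕ.≟ 0 ×-dec suc (toℕ i) ℕ.≟ k)

-- Phrased through the decision of CycAdj so that, for a concrete k, the pairs of the wrong
-- kind are dismissed by absurd patterns.
inducedCycle : ∀ {n} (G : Graph n) k (f : Fin k → Fin n) →
  (∀ i j → True (cycAdj? k i j) → Adj G (f i) (f j)) →
  (∀ i j → i ≢ j → False (cycAdj? k i j) → f i ≢ f j × ¬ Adj G (f i) (f j)) →
  InducedCycle G k f
inducedCycle G k f edge non-edge = injective , λ i j → adjacent⇒cyclic i j , edge i j ∘ fromWitness
  where
  injective : Injective _≡_ _≡_ f
  injective {i} {j} fi≡fj with i ≟ j | cycAdj? k i j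
  ... | yes i≡j | _       = i≡j
  ... | no  _   | yes cyc = contradiction fi≡fj (Adj⇒≢ G (edge i j (fromWitness cyc)))
  ... | no  i≢j | no ¬cyc = contradiction fi≡fj (proj₁ (non-edge i j i≢j (fromWitnessFalse ¬cyc)))

  adjacent⇒cyclic : ∀ i j → Adj G (f i) (f j) → CycAdj k i j
  adjacent⇒cyclic i j fi~fj = decidable-stable (cycAdj? k i j) (cyclic (i ≟ j))
    where
    cyclic : Dec (i ≡ j) → ¬ ¬ CycAdj k i j
    cyclic (yes refl) _    = Adj⇒≢ G fi~fj refl
    cyclic (no i≢j)   ¬cyc = proj₂ (non-edge i j i≢j (fromWitnessFalse ¬cyc)) fi~fj

module _ {n} (G : Graph n) (chordal : Chordal G) where

  no-C4 : ∀ {a b c d} → Adj G a b → Adj G b c → Adj G c d → Adj G d a →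
          ¬ Adj G a c → ¬ Adj G b d → a ≢ c → b ≢ d → ⊥
  no-C4 {a} {b} {c} {d} ab bc cd da ¬ac ¬bd a≢c b≢d =
    chordal 4 ≤-refl f (inducedCycle G 4 f edge non-edge)
    where
    f : Fin 4 → Fin n
    f 0F = a
    f 1F = b
    f 2F = c
    f 3F = d
    edge : ∀ i j → True (cycAdj? 4 i j) → Adj G (f i) (f j)
    edge 0F 1F _ = ab
    edge 1F 2F _ = bc
    edge 2F 3F _ = cd
    edge 3F 0F _ = da
    edge 1F 0F _ = Adj-sym G ab
    edge 2F 1F _ = Adj-sym G bc
    edge 3F 2F _ = Adj-sym G cd
    edge 0F 3F _ = Adj-sym G da
    edge 0F 0F ()
    edge 0F 2F ()
    edge 1F 1F ()
    edge 1F 3F ()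
    edge 2F 0F ()
    edge 2F 2F ()
    edge 3F 1F ()
    edge 3F 3F ()
    non-edge : ∀ i j → i ≢ j → False (cycAdj? 4 i j) → f i ≢ f j × ¬ Adj G (f i) (f j)
    non-edge 0F 2F _ _ = a≢c , ¬ac
    non-edge 2F 0F _ _ = ≢-sym a≢c , ¬Adj-sym G ¬ac
    non-edge 1F 3F _ _ = b≢d , ¬bd
    non-edge 3F 1F _ _ = ≢-sym b≢d , ¬Adj-sym G ¬bd
    non-edge 0F 0F i≢i _ = contradiction refl i≢i
    non-edge 1F 1F i≢i _ = contradiction refl i≢i
    non-edge 2F 2F i≢i _ = contradiction refl i≢i
    non-edge 3F 3F i≢i _ = contradiction refl i≢i
    non-edge 0F 1F _ ()
    non-edge 1F 2F _ ()
    non-edge 2F 3F _ ()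
    non-edge 3F 0F _ ()
    non-edge 1F 0F _ ()
    non-edge 2F 1F _ ()
    non-edge 3F 2F _ ()
    non-edge 0F 3F _ ()

  no-C5 : ∀ {a b c d e} → Adj G a b → Adj G b c → Adj G c d → Adj G d e → Adj G e a →
          ¬ Adj G a c → ¬ Adj G a d → ¬ Adj G b d → ¬ Adj G b e → ¬ Adj G c e →
          a ≢ c → a ≢ d → b ≢ d → b ≢ e → c ≢ e → ⊥
  no-C5 {a} {b} {c} {d} {e} ab bc cd de ea ¬ac ¬ad ¬bd ¬be ¬ce a≢c a≢d b≢d b≢e c≢e =
    chordal 5 (s≤s (s≤s (s≤s (s≤s z≤n)))) f (inducedCycle G 5 f edge non-edge)
    where
    f : Fin 5 → Fin n
    f 0F = a
    f 1F = b
    f 2F = c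
    f 3F = d
    f 4F = e
    edge : ∀ i j → True (cycAdj? 5 i j) → Adj G (f i) (f j)
    edge 0F 1F _ = ab
    edge 1F 2F _ = bc
    edge 2F 3F _ = cd
    edge 3F 4F _ = de
    edge 4F 0F _ = ea
    edge 1F 0F _ = Adj-sym G ab
    edge 2F 1F _ = Adj-sym G bc
    edge 3F 2F _ = Adj-sym G cd
    edge 4F 3F _ = Adj-sym G de
    edge 0F 4F _ = Adj-sym G ea
    edge 0F 0F ()
    edge 0F 2F ()
    edge 0F 3F ()
    edge 1F 1F ()
    edge 1F 3F ()
    edge 1F 4F ()
    edge 2F 0F ()
    edge 2F 2F ()
    edge 2F 4F ()
    edge 3F 0F ()
    edge 3F 1F ()
    edge 3F 3F ()
    edge 4F 1F ()
    edge 4F 2F ()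
    edge 4F 4F ()
    non-edge : ∀ i j → i ≢ j → False (cycAdj? 5 i j) → f i ≢ f j × ¬ Adj G (f i) (f j)
    non-edge 0F 2F _ _ = a≢c , ¬ac
    non-edge 0F 3F _ _ = a≢d , ¬ad
    non-edge 1F 3F _ _ = b≢d , ¬bd
    non-edge 1F 4F _ _ = b≢e , ¬be
    non-edge 2F 4F _ _ = c≢e , ¬ce
    non-edge 2F 0F _ _ = ≢-sym a≢c , ¬Adj-sym G ¬ac
    non-edge 3F 0F _ _ = ≢-sym a≢d , ¬Adj-sym G ¬ad
    non-edge 3F 1F _ _ = ≢-sym b≢d , ¬Adj-sym G ¬bd
    non-edge 4F 1F _ _ = ≢-sym b≢e , ¬Adj-sym G ¬be
    non-edge 4F 2F _ _ = ≢-sym c≢e , ¬Adj-sym G ¬ce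
    non-edge 0F 0F i≢i _ = contradiction refl i≢i
    non-edge 1F 1F i≢i _ = contradiction refl i≢i
    non-edge 2F 2F i≢i _ = contradiction refl i≢i
    non-edge 3F 3F i≢i _ = contradiction refl i≢i
    non-edge 4F 4F i≢i _ = contradiction refl i≢i
    non-edge 0F 1F _ ()
    non-edge 1F 2F _ ()
    non-edge 2F 3F _ ()
    non-edge 3F 4F _ ()
    non-edge 4F 0F _ ()
    non-edge 1F 0F _ ()
    non-edge 2F 1F _ ()
    non-edge 3F 2F _ ()
    non-edge 4F 3F _ ()
    non-edge 0F 4F _ ()

module _ {n} {P : Fin n → Set} (P? : Decidable P) where

  toSubset : Subset n
  toSubset = tabulate (Dec.isYes ∘ P?)

  ∈-toSubset⁺ : ∀ {x} → P x → x ∈ toSubset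
  ∈-toSubset⁺ {x} px =
    lookup⇒[]= x toSubset (trans (lookup∘tabulate _ x) (Equivalence.to T-≡ (fromWitness px)))

  ∈-toSubset⁻ : ∀ {x} → x ∈ toSubset → P x
  ∈-toSubset⁻ {x} x∈ =
    toWitness (Equivalence.from T-≡ (trans (≡.sym (lookup∘tabulate _ x)) ([]=⇒lookup x∈)))

toSubset-⊂ : ∀ {n} {P Q : Fin n → Set} (P? : Decidable P) (Q? : Decidable Q) →
             (∀ {x} → P x → Q x) → ∀ {y} → Q y → ¬ P y → toSubset P? ⊂ toSubset Q?
toSubset-⊂ P? Q? P⇒Q qy ¬py =
  (∈-toSubset⁺ Q? ∘ P⇒Q ∘ ∈-toSubset⁻ P?) , _ , ∈-toSubset⁺ Q? qy , ¬py ∘ ∈-toSubset⁻ P?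

⊂-minimal : ∀ {n m} {P : Fin n → Set} → Decidable P → (f : Fin n → Subset m) →
            ∃ P → ∃ λ a → P a × ∀ c → P c → f c ⊄ f a
⊂-minimal {P = P} P? f (a , pa) = go a pa (⊂-wellFounded (f a))
  where
  go : ∀ a → P a → Acc _⊂_ (f a) → ∃ λ a → P a × ∀ c → P c → f c ⊄ f a
  go a pa (acc smaller) with any? (λ c → P? c ×-dec f c ⊂? f a)
  ... | yes (c , pc , fc⊂fa) = go c pc (smaller fc⊂fa)
  ... | no ¬below            = a , pa , λ c pc fc⊂fa → ¬below (c , pc , fc⊂fa)

module TwoChordalSplit {n} (A B : Graph n) (chordal-A : Chordal A) (chordal-B : Chordal B)
  (W : Subset n) (covered : ∀ {u v} → u ∈ W → v ∈ W → u ≢ v → Adj A u v ⊎ Adj B u v) where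

  ¬B⇒A : ∀ {u v} → u ∈ W → v ∈ W → u ≢ v → ¬ Adj B u v → Adj A u v
  ¬B⇒A u∈W v∈W u≢v ¬Buv = [ id , flip contradiction ¬Buv ]′ (covered u∈W v∈W u≢v)

  ¬A⇒B : ∀ {u v} → u ∈ W → v ∈ W → u ≢ v → ¬ Adj A u v → Adj B u v
  ¬A⇒B u∈W v∈W u≢v ¬Auv = [ flip contradiction ¬Auv , id ]′ (covered u∈W v∈W u≢v)

  Free : Subset n → Fin n → Set
  Free K u = u ∈ W × u ∉ K

  Conflict : Subset n → Fin n → Fin n → Set
  Conflict K u v = Free K u × Free K v × u ≢ v × ¬ Adj B u v

  conflicting? : ∀ K → Decidable (∃ ∘ Conflict K)
  conflicting? K u = any? λ v → free? u ×-dec free? v ×-dec ¬? (u ≟ v) ×-dec ¬? (adj? B u v)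
    where
    free? : Decidable (Free K)
    free? x = x ∈? W ×-dec ¬? (x ∈? K)

  Missed : Subset n → Fin n → Fin n → Set
  Missed K a x = x ∈ K × ¬ Adj A a x

  missed? : ∀ K a → Decidable (Missed K a)
  missed? K a x = x ∈? K ×-dec ¬? (adj? A a x)

  conflicts : Subset n → Subset n
  conflicts K = toSubset (conflicting? K)

  module Step (K : Subset n) (K-clique : IsClique A K) (K⊆W : K ⊆ W) {a b : Fin n}
    (a∈W : a ∈ W) (a∉K : a ∉ K) (b∈W : b ∈ W) (b∉K : b ∉ K) (a≢b : a ≢ b) (¬Bab : ¬ Adj B a b)
    (minimal : ∀ c → ∃ (Conflict K c) → toSubset (missed? K c) ⊄ toSubset (missed? K a)) where

    a-b : Conflict K a b
    a-b = (a∈W , a∉K) , (b∈W , b∉K) , a≢b , ¬Bab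

    Aab : Adj A a b
    Aab = ¬B⇒A a∈W b∈W a≢b ¬Bab

    unseen : ∀ {c} → ∃ (Conflict K c) → (∀ {x} → Missed K c x → Missed K a x) →
             ∀ {l} → Missed K a l → ¬ Adj A c l
    unseen {c} c-conflicts c⊆a l-missed Acl =
      minimal c c-conflicts (toSubset-⊂ (missed? K c) (missed? K a) c⊆a l-missed (λ m → proj₂ m Acl))

    missed-⊆ : ∀ {c l} → c ∉ K → Adj A a c → Missed K a l → Adj A c l →
               ∀ {x} → Missed K c x → Missed K a x
    missed-⊆ c∉K Aac (l∈K , ¬Aal) Acl (x∈K , ¬Acx) = x∈K , λ Aax →
      no-C4 A chordal-A Aac Acl (K-clique _ _ l∈K x∈K (Adj-¬Adj⇒≢ A Acl ¬Acx)) (Adj-sym A Aax)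
        ¬Aal ¬Acx (≢-sym (∈∉⇒≢ l∈K a∉K)) (≢-sym (∈∉⇒≢ x∈K c∉K))

    b-unseen : ∀ {l} → Missed K a l → ¬ Adj A b l
    b-unseen l-missed Abl =
      unseen (a , b-a) (missed-⊆ b∉K Aab l-missed Abl) l-missed Abl
      where
      b-a : Conflict K b a
      b-a = (b∈W , b∉K) , (a∈W , a∉K) , ≢-sym a≢b , ¬Adj-sym B ¬Bab

    missed⇒Ba : ∀ {l} → Missed K a l → Adj B a l
    missed⇒Ba (l∈K , ¬Aal) = ¬A⇒B a∈W (K⊆W l∈K) (≢-sym (∈∉⇒≢ l∈K a∉K)) ¬Aal

    missed⇒Bb : ∀ {l} → Missed K a l → Adj B b l
    missed⇒Bb {l} l-missed@(l∈K , _) = decidable-stable (adj? B b l) λ ¬Bbl →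
      b-unseen l-missed (¬B⇒A b∈W (K⊆W l∈K) (≢-sym (∈∉⇒≢ l∈K b∉K)) ¬Bbl)

    missed-B-adjacent : ∀ {l v} → Missed K a l → Missed K a v → l ≢ v → ¬ ¬ Adj B l v
    missed-B-adjacent l-missed v-missed l≢v ¬Blv =
      no-C4 B chordal-B (missed⇒Ba l-missed) (Adj-sym B (missed⇒Bb l-missed)) (missed⇒Bb v-missed)
        (Adj-sym B (missed⇒Ba v-missed)) ¬Bab ¬Blv a≢b l≢v

    missed-⊆-via-b : ∀ {q l} → q ∉ K → q ≢ a → Adj A b q → Missed K a l → Adj A q l →
                     ∀ {x} → Missed K q x → Missed K a x
    missed-⊆-via-b {q} {l} q∉K q≢a Abq l-missed@(l∈K , ¬Aal) Aql {x} (x∈K , ¬Aqx) = x∈K , ¬Aax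
      where
      Alx : Adj A l x
      Alx = K-clique l x l∈K x∈K (Adj-¬Adj⇒≢ A Aql ¬Aqx)
      a≢l : a ≢ l
      a≢l = ≢-sym (∈∉⇒≢ l∈K a∉K)
      b≢l : b ≢ l
      b≢l = ≢-sym (∈∉⇒≢ l∈K b∉K)
      q≢x : q ≢ x
      q≢x = ≢-sym (∈∉⇒≢ x∈K q∉K)
      ¬Aax : ¬ Adj A a x
      ¬Aax Aax with adj? A a q | adj? A b x
      ... | yes Aaq | _ = no-C4 A chordal-A Aaq Aql Alx (Adj-sym A Aax) ¬Aal ¬Aqx a≢l q≢x
      ... | no ¬Aaq | yes Abx =
        no-C4 A chordal-A Abq Aql Alx (Adj-sym A Abx) (b-unseen l-missed) ¬Aqx b≢l q≢x
      ... | no ¬Aaq | no ¬Abx =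
        no-C5 A chordal-A Aab Abq Aql Alx (Adj-sym A Aax) ¬Aaq ¬Aal (b-unseen l-missed) ¬Abx ¬Aqx
          (≢-sym q≢a) a≢l b≢l (≢-sym (∈∉⇒≢ x∈K b∉K)) q≢x

    missed-free-¬B⇒A : ∀ {l q} → Missed K a l → Free K q → ¬ Adj B l q → Adj A q l
    missed-free-¬B⇒A (l∈K , _) (q∈W , q∉K) ¬Blq =
      Adj-sym A (¬B⇒A (K⊆W l∈K) q∈W (∈∉⇒≢ l∈K q∉K) ¬Blq)

    missed-free-B-adjacent : ∀ {l q} → Missed K a l → Free K q → q ≢ a → ¬ ¬ Adj B l q
    missed-free-B-adjacent {l} {q} l-missed@(l∈K , _) q-free@(q∈W , q∉K) q≢a ¬Blq
      with adj? B a q | adj? B b q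
    ... | no ¬Baq | _ = unseen (a , q-a) (missed-⊆ q∉K Aaq l-missed Aql) l-missed Aql
      where
      Aql : Adj A q l
      Aql = missed-free-¬B⇒A l-missed q-free ¬Blq
      Aaq : Adj A a q
      Aaq = ¬B⇒A a∈W q∈W (≢-sym q≢a) ¬Baq
      q-a : Conflict K q a
      q-a = q-free , (a∈W , a∉K) , q≢a , ¬Adj-sym B ¬Baq
    ... | yes _ | no ¬Bbq = unseen (b , q-b) (missed-⊆-via-b q∉K q≢a Abq l-missed Aql) l-missed Aql
      where
      Aql : Adj A q l
      Aql = missed-free-¬B⇒A l-missed q-free ¬Blq
      q≢b : q ≢ b
      q≢b refl = b-unseen l-missed Aql
      Abq : Adj A b q
      Abq = ¬B⇒A b∈W q∈W (≢-sym q≢b) ¬Bbq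
      q-b : Conflict K q b
      q-b = q-free , (b∈W , b∉K) , q≢b , ¬Adj-sym B ¬Bbq
    ... | yes Baq | yes Bbq =
      no-C4 B chordal-B (missed⇒Ba l-missed) (Adj-sym B (missed⇒Bb l-missed)) Bbq (Adj-sym B Baq)
        ¬Bab ¬Blq a≢b (∈∉⇒≢ l∈K q∉K)

    K′ : Subset n
    K′ = toSubset (λ x → x ≟ a ⊎-dec x ∈? K ×-dec adj? A a x)

    a∈K′ : a ∈ K′
    a∈K′ = ∈-toSubset⁺ _ (inj₁ refl)

    K′-clique : IsClique A K′
    K′-clique u v u∈K′ v∈K′ u≢v with ∈-toSubset⁻ _ u∈K′ | ∈-toSubset⁻ _ v∈K′
    ... | inj₁ refl      | inj₁ refl      = contradiction refl u≢v
    ... | inj₁ refl      | inj₂ (_ , Aav) = Aav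
    ... | inj₂ (_ , Aau) | inj₁ refl      = Adj-sym A Aau
    ... | inj₂ (u∈K , _) | inj₂ (v∈K , _) = K-clique u v u∈K v∈K u≢v

    K′⊆W : K′ ⊆ W
    K′⊆W u∈K′ with ∈-toSubset⁻ _ u∈K′
    ... | inj₁ refl      = a∈W
    ... | inj₂ (u∈K , _) = K⊆W u∈K

    free-K′ : ∀ {u} → Free K′ u → u ≢ a × (Free K u ⊎ Missed K a u)
    free-K′ {u} (u∈W , u∉K′) = u∉K′ ∘ ∈-toSubset⁺ _ ∘ inj₁ , free-or-missed (u ∈? K)
      where
      free-or-missed : Dec (u ∈ K) → Free K u ⊎ Missed K a u
      free-or-missed (yes u∈K) = inj₂ (u∈K , u∉K′ ∘ ∈-toSubset⁺ _ ∘ inj₂ ∘ (u∈K ,_))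
      free-or-missed (no u∉K)  = inj₁ (u∈W , u∉K)

    conflict-K′⇒K : ∀ {u v} → Conflict K′ u v → Conflict K u v
    conflict-K′⇒K (u-free , v-free , u≢v , ¬Buv) with free-K′ u-free | free-K′ v-free
    ... | _ , inj₁ u-free′ | _ , inj₁ v-free′ = u-free′ , v-free′ , u≢v , ¬Buv
    ... | _ , inj₂ u-missed | _ , inj₂ v-missed =
      ⊥-elim (missed-B-adjacent u-missed v-missed u≢v ¬Buv)
    ... | _ , inj₂ u-missed | v≢a , inj₁ v-free′ =
      ⊥-elim (missed-free-B-adjacent u-missed v-free′ v≢a ¬Buv)
    ... | u≢a , inj₁ u-free′ | _ , inj₂ v-missed =
      ⊥-elim (missed-free-B-adjacent v-missed u-free′ u≢a (¬Adj-sym B ¬Buv))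

    conflicts-shrink : conflicts K′ ⊂ conflicts K
    conflicts-shrink = toSubset-⊂ (conflicting? K′) (conflicting? K)
      (λ (v , c) → v , conflict-K′⇒K c) (b , a-b) (λ (_ , (_ , a∉K′) , _) → a∉K′ a∈K′)

  split-from : ∀ K → IsClique A K → K ⊆ W → Acc _⊂_ (conflicts K) →
               ∃[ K ] IsClique A K × IsClique B (W ∩ ∁ K)
  split-from K K-clique K⊆W (acc smaller) with any? (conflicting? K)
  ... | no no-conflict = K , K-clique , λ u v u∈ v∈ u≢v →
    decidable-stable (adj? B u v) λ ¬Buv → no-conflict (u , v , free u∈ , free v∈ , u≢v , ¬Buv)
    where
    free : ∀ {x} → x ∈ W ∩ ∁ K → Free K x
    free {x} x∈ = proj₁ (x∈p∩q⁻ W (∁ K) x∈) , x∈∁p⇒x∉p (proj₂ (x∈p∩q⁻ W (∁ K) x∈))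
  ... | yes some with ⊂-minimal (conflicting? K) (toSubset ∘ missed? K) some
  ... | a , (b , (a∈W , a∉K) , (b∈W , b∉K) , a≢b , ¬Bab) , minimal =
    split-from K′ K′-clique K′⊆W (smaller conflicts-shrink)
    where open Step K K-clique K⊆W a∈W a∉K b∈W b∉K a≢b ¬Bab minimal

  split : ∃[ K ] IsClique A K × IsClique B (W ∩ ∁ K)
  split = split-from ∅ (λ _ _ u∈∅ → contradiction u∈∅ ∉⊥) (λ u∈∅ → contradiction u∈∅ ∉⊥)
                     (⊂-wellFounded _)

triple : ∀ {n} → Fin n → Fin n → Fin n → Subset n
triple x y z = ⁅ x ⁆ ∪ ⁅ y ⁆ ∪ ⁅ z ⁆

x∈triple : ∀ {n} {x y z : Fin n} → x ∈ triple x y z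
x∈triple {x = x} = x∈p∪q⁺ (inj₁ (x∈⁅x⁆ x))

y∈triple : ∀ {n} {x y z : Fin n} → y ∈ triple x y z
y∈triple {y = y} = x∈p∪q⁺ (inj₂ (x∈p∪q⁺ (inj₁ (x∈⁅x⁆ y))))

z∈triple : ∀ {n} {x y z : Fin n} → z ∈ triple x y z
z∈triple {z = z} = x∈p∪q⁺ (inj₂ (x∈p∪q⁺ (inj₂ (x∈⁅x⁆ z))))

∣⁅x⁆∪p∣≡1+∣p∣ : ∀ {n} {x : Fin n} {p} → x ∉ p → ∣ ⁅ x ⁆ ∪ p ∣ ≡ suc ∣ p ∣
∣⁅x⁆∪p∣≡1+∣p∣ {x = Fin.zero}  {outside ∷ p} _   = cong (suc ∘ ∣_∣) (∪-identityˡ p)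
∣⁅x⁆∪p∣≡1+∣p∣ {x = Fin.zero}  {inside ∷ p}  x∉p = contradiction here x∉p
∣⁅x⁆∪p∣≡1+∣p∣ {x = Fin.suc x} {outside ∷ p} x∉p = ∣⁅x⁆∪p∣≡1+∣p∣ (x∉p ∘ there)
∣⁅x⁆∪p∣≡1+∣p∣ {x = Fin.suc x} {inside ∷ p}  x∉p = cong suc (∣⁅x⁆∪p∣≡1+∣p∣ (x∉p ∘ there))

∣triple∣≡3 : ∀ {n} {x y z : Fin n} → x ≢ y → x ≢ z → y ≢ z → ∣ triple x y z ∣ ≡ 3
∣triple∣≡3 {y = y} {z} x≢y x≢z y≢z =
  trans (∣⁅x⁆∪p∣≡1+∣p∣ (not-in x≢y x≢z))
        (cong suc (trans (∣⁅x⁆∪p∣≡1+∣p∣ (y≢z ∘ x∈⁅y⁆⇒x≡y z)) (cong suc (∣⁅x⁆∣≡1 z))))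
  where
  not-in : ∀ {x} → x ≢ y → x ≢ z → x ∉ ⁅ y ⁆ ∪ ⁅ z ⁆
  not-in x≢y x≢z x∈ = [ x≢y ∘ x∈⁅y⁆⇒x≡y y , x≢z ∘ x∈⁅y⁆⇒x≡y z ]′ (x∈p∪q⁻ _ _ x∈)

exclusive⇒universal : ∀ {t n} (c : Coloring t n) → IsTK c 3 → ∀ {u w k} → u ≢ w →
                      (∀ i → Adj (graph c i) u w → i ≡ k) → Universal (graph c k) u
exclusive⇒universal c (tk , _) {u} {w} u≢w only-k z u≢z with z ≟ w
... | yes refl with covers c u z u≢z
...   | i , uz = subst (λ i → Adj (graph c i) u z) (only-k i uz) uz
exclusive⇒universal c (tk , _) {u} {w} u≢w only-k z u≢z
    | no z≢w with tk (triple u w z) (∣triple∣≡3 u≢w u≢z (≢-sym z≢w))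
...   | i , clique = subst (λ i → Adj (graph c i) u z) (only-k i (clique u w x∈triple y∈triple u≢w))
                           (clique u z x∈triple z∈triple u≢z)

coverByColours : ∀ {t n} {c : Coloring t n} (K : Fin t → Subset n) →
                 (∀ i → IsClique (graph c i) (K i)) → (∀ v → ∃[ i ] v ∈ K i) → StrongCover c t
coverByColours K K-clique covering = record
  { colour = id ; colour-inj = id ; clique = K ; isClique = K-clique ; coversAll = covering }

twoChordal⇒strongCover₃ : ∀ {n} (c : Coloring 3 n) → IsTK c 3 →
               Chordal (graph c 0F) → Chordal (graph c 1F) → StrongCover c 3
twoChordal⇒strongCover₃ {n} c tk chordal₀ chordal₁ = coverByColours cliques isClique covering
  where
  U W : Subset n
  U = toSubset (universal? (graph c 2F))
  W = ∁ U

  covered : ∀ {u v} → u ∈ W → v ∈ W → u ≢ v → Adj (graph c 0F) u v ⊎ Adj (graph c 1F) u v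
  covered {u} {v} u∈W _ u≢v with adj? (graph c 0F) u v | adj? (graph c 1F) u v
  ... | yes A₀ | _      = inj₁ A₀
  ... | no _   | yes A₁ = inj₂ A₁
  ... | no ¬A₀ | no ¬A₁ =
    contradiction (∈-toSubset⁺ _ (exclusive⇒universal c tk u≢v only-2)) (x∈∁p⇒x∉p u∈W)
    where
    only-2 : ∀ i → Adj (graph c i) u v → i ≡ 2F
    only-2 0F A₀ = contradiction A₀ ¬A₀
    only-2 1F A₁ = contradiction A₁ ¬A₁
    only-2 2F _  = refl

  open TwoChordalSplit (graph c 0F) (graph c 1F) chordal₀ chordal₁ W covered using (split)

  cliques : Fin 3 → Subset n
  cliques 0F = proj₁ split
  cliques 1F = W ∩ ∁ (proj₁ split)
  cliques 2F = U

  isClique : ∀ i → IsClique (graph c i) (cliques i)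
  isClique 0F = proj₁ (proj₂ split)
  isClique 1F = proj₂ (proj₂ split)
  isClique 2F u v u∈U _ = ∈-toSubset⁻ _ u∈U v

  covering : ∀ v → ∃[ i ] v ∈ cliques i
  covering v with v ∈? U | v ∈? proj₁ split
  ... | yes v∈U | _     = 2F , v∈U
  ... | no _    | yes v∈K = 0F , v∈K
  ... | no v∉U  | no v∉K  = 1F , x∈p∩q⁺ (x∉p⇒x∈∁p v∉U , x∉p⇒x∈∁p v∉K)

strongCover₀? : ∀ {t n} (c : Coloring t n) → Dec (StrongCover c 0)
strongCover₀? {n = zero}  c = yes record
  { colour = λ () ; colour-inj = λ { {()} } ; clique = λ () ; isClique = λ () ; coversAll = λ () }
strongCover₀? {n = suc _} c = no λ cover → ¬Fin0 (proj₁ (StrongCover.coversAll cover Fin.zero))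

module _ {t n} (c : Coloring t n) where

  monochromatic⇔strongCover₁ : (∃[ i ] IsClique (graph c i) ⊤) ⇔ StrongCover c 1
  monochromatic⇔strongCover₁ = mk⇔ from-clique to-clique
    where
    from-clique : ∃[ i ] IsClique (graph c i) ⊤ → StrongCover c 1
    from-clique (i , ⊤-clique) = record
      { colour = const i ; colour-inj = λ { {0F} {0F} _ → refl } ; clique = const ⊤
      ; isClique = const ⊤-clique ; coversAll = λ _ → 0F , ∈⊤ }
    to-clique : StrongCover c 1 → ∃[ i ] IsClique (graph c i) ⊤
    to-clique cover = colour 0F , λ u v _ _ → isClique 0F u v (everything u) (everything v)
      where
      open StrongCover cover
      everything : ∀ x → x ∈ clique 0F
      everything x with coversAll x
      ... | 0F , x∈ = x∈

  TwoPartition : Set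
  TwoPartition = ∃[ i ] ∃[ j ] i ≢ j × ∃[ S ] IsClique (graph c i) S × IsClique (graph c j) (∁ S)

  twoPartition⇔strongCover₂ : TwoPartition ⇔ StrongCover c 2
  twoPartition⇔strongCover₂ = mk⇔ from-partition to-partition
    where
    from-partition : TwoPartition → StrongCover c 2
    from-partition (i , j , i≢j , S , S-clique , ∁S-clique) = record
      { colour = colour ; colour-inj = colour-inj ; clique = clique
      ; isClique = isClique ; coversAll = λ v → [ (λ v∈S → 0F , v∈S) , (λ v∉S → 1F , x∉p⇒x∈∁p v∉S) ]′
                                                   (Dec.toSum (v ∈? S)) }
      where
      colour : Fin 2 → Fin t
      colour 0F = i
      colour 1F = j
      colour-inj : Injective _≡_ _≡_ colour
      colour-inj {0F} {0F} _   = refl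
      colour-inj {0F} {1F} i≡j = contradiction i≡j i≢j
      colour-inj {1F} {0F} j≡i = contradiction (≡.sym j≡i) i≢j
      colour-inj {1F} {1F} _   = refl
      clique : Fin 2 → Subset n
      clique 0F = S
      clique 1F = ∁ S
      isClique : ∀ k → IsClique (graph c (colour k)) (clique k)
      isClique 0F = S-clique
      isClique 1F = ∁S-clique
    to-partition : StrongCover c 2 → TwoPartition
    to-partition cover = colour 0F , colour 1F , (λ ()) ∘ colour-inj , clique 0F ,
      isClique 0F , λ u v u∈ v∈ → isClique 1F u v (second u∈) (second v∈)
      where
      open StrongCover cover
      second : ∀ {x} → x ∈ ∁ (clique 0F) → x ∈ clique 1F
      second {x} x∈∁ with coversAll x
      ... | 0F , x∈ = contradiction x∈ (x∈∁p⇒x∉p x∈∁)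
      ... | 1F , x∈ = x∈

  strongCover₁? : Dec (StrongCover c 1)
  strongCover₁? = Dec.map monochromatic⇔strongCover₁ (any? λ i → clique? (graph c i) ⊤)

  strongCover₂? : Dec (StrongCover c 2)
  strongCover₂? = Dec.map twoPartition⇔strongCover₂
    (any? λ i → any? λ j → ¬? (i ≟ j) ×-dec anySubset? λ S → clique? (graph c i) S ×-dec clique? (graph c j) (∁ S))

least-below : ∀ {P : ℕ → Set} k → (∀ m → m < k → Dec (P m)) → P k →
              Σ ℕ λ m → (P m × ∀ m′ → P m′ → m ≤ m′) × m ≤ k
least-below {P} k P? pk = search k 0 (+-identityʳ k) (λ _ ())
  where
  least : ∀ {i} → (∀ m → m < i → ¬ P m) → ∀ m′ → P m′ → i ≤ m′
  least none m′ pm′ = ≮⇒≥ λ m′<i → none m′ m′<i pm′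

  below : ∀ {d i} → suc d + i ≡ k → i < k
  below {d} {i} d+i≡k = subst (i <_) d+i≡k (s≤s (m≤n+m i d))

  search : ∀ d i → d + i ≡ k → (∀ m → m < i → ¬ P m) → Σ ℕ λ m → (P m × ∀ m′ → P m′ → m ≤ m′) × m ≤ k
  search zero    i refl none = i , (pk , least none) , ≤-refl
  search (suc d) i d+i≡k none with P? i (below d+i≡k)
  ... | yes pi = i , (pi , least none) , <⇒≤ (below d+i≡k)
  ... | no ¬pi = search d (suc i) (trans (+-suc d i) d+i≡k) none′
    where
    none′ : ∀ m → m < suc i → ¬ P m
    none′ m m<1+i with m<1+n⇒m<n∨m≡n m<1+i
    ... | inj₁ m<i  = none m m<i
    ... | inj₂ refl = ¬pi

chordal-θ≤3 : (n : ℕ) (c : Coloring 3 n) → IsTK c 3 → (∀ i → Chordal (graph c i)) →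
              Σ ℕ λ m → IsTheta c m × m ≤ 3
chordal-θ≤3 n c tk chordal = least-below 3 smaller? (twoChordal⇒strongCover₃ c tk (chordal 0F) (chordal 1F))
  where
  smaller? : ∀ m → m < 3 → Dec (StrongCover c m)
  smaller? 0 _ = strongCover₀? c
  smaller? 1 _ = strongCover₁? c
  smaller? 2 _ = strongCover₂? c
  smaller? (suc (suc (suc _))) (s≤s (s≤s (s≤s ())))

intervalGraph : ∀ {n} (l r : Fin n → ℕ) → Graph n
intervalGraph l r = record
  { adj    = λ u v → not (does (u ≟ v)) ∧ ((l u ≤ᵇ r v) ∧ (l v ≤ᵇ r u))
  ; sym    = λ u v → cong₂ _∧_ (cong not (≟-sym u v)) (∧-comm (l u ≤ᵇ r v) (l v ≤ᵇ r u))
  ; irrefl = λ v → cong (λ b → not b ∧ _) (dec-true (v ≟ v) refl)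
  }
  where
  ≟-sym : ∀ {n} (u v : Fin n) → does (u ≟ v) ≡ does (v ≟ u)
  ≟-sym u v with u ≟ v
  ... | yes refl = ≡.sym (dec-true (u ≟ u) refl)
  ... | no u≢v   = ≡.sym (dec-false (v ≟ u) (≢-sym u≢v))

intervalGraph-isInterval : ∀ {n} (l r : Fin n → ℕ) → (∀ v → l v ≤ r v) → IsInterval (intervalGraph l r)
intervalGraph-isInterval l r l≤r = l , r , l≤r , λ u v u≢v → intersect u v u≢v
  where
  intersect : ∀ u v → u ≢ v → (Adj (intervalGraph l r) u v → l u ≤ r v × l v ≤ r u)
                          × (l u ≤ r v × l v ≤ r u → Adj (intervalGraph l r) u v)
  intersect u v u≢v rewrite dec-false (u ≟ v) u≢v =
      (λ e → Product.map (≤ᵇ⇒≤ _ _) (≤ᵇ⇒≤ _ _) (Equivalence.to T-∧ (Equivalence.from T-≡ e)))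
    , (λ (p , q) → Equivalence.to T-≡ (Equivalence.from T-∧ (≤⇒≤ᵇ p , ≤⇒≤ᵇ q)))

allSubsets? : ∀ {n} {P : Subset n → Set} → Decidable P → Dec (∀ S → P S)
allSubsets? P? = map′ (λ ¬counterexample S → decidable-stable (P? S) (¬counterexample ∘ (S ,_)))
                      (λ all (S , ¬pS) → ¬pS (all S))
                      (¬? (anySubset? (¬? ∘ P?)))

module K₉ where

  left right : Fin 3 → Vec ℕ 9
  left  0F = 0  ∷ 0  ∷ 0  ∷ 0  ∷ 2  ∷ 4  ∷ 1  ∷ 0  ∷ 3  ∷ []
  left  1F = 1  ∷ 0  ∷ 3  ∷ 0  ∷ 0  ∷ 0  ∷ 4  ∷ 0  ∷ 2  ∷ []
  left  2F = 2  ∷ 0  ∷ 3  ∷ 0  ∷ 4  ∷ 1  ∷ 0  ∷ 0  ∷ 0  ∷ []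
  right 0F = 12 ∷ 12 ∷ 12 ∷ 1  ∷ 3  ∷ 4  ∷ 2  ∷ 0  ∷ 3  ∷ []
  right 1F = 2  ∷ 0  ∷ 3  ∷ 12 ∷ 12 ∷ 12 ∷ 4  ∷ 1  ∷ 3  ∷ []
  right 2F = 2  ∷ 1  ∷ 4  ∷ 0  ∷ 4  ∷ 3  ∷ 12 ∷ 12 ∷ 12 ∷ []

  G : Fin 3 → Graph 9
  G i = intervalGraph (lookup (left i)) (lookup (right i))

  colouring : Coloring 3 9
  colouring = record
    { graph  = G
    ; covers = from-yes (all? λ u → all? λ v → ¬? (u ≟ v) →-dec any? λ i → adj? (G i) u v)
    }

  isTK : IsTK colouring 3
  isTK = from-yes (allSubsets? λ S → ∣ S ∣ ℕ.≟ 3 →-dec any? λ i → clique? (G i) S)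
       , λ { (s≤s (s≤s (s≤s ()))) }

  isInterval : ∀ i → IsInterval (G i)
  isInterval i = intervalGraph-isInterval _ _
    (from-yes (all? λ j → all? λ v → lookup (left j) v ℕ.≤? lookup (right j) v) i)

  block : Fin 3 → Subset 9
  block 0F = inside  ∷ inside  ∷ inside  ∷ outside ∷ outside ∷ outside ∷ outside ∷ outside ∷ outside ∷ []
  block 1F = outside ∷ outside ∷ outside ∷ inside  ∷ inside  ∷ inside  ∷ outside ∷ outside ∷ outside ∷ []
  block 2F = outside ∷ outside ∷ outside ∷ outside ∷ outside ∷ outside ∷ inside  ∷ inside  ∷ inside  ∷ []

  θ≡3 : IsTheta colouring 3
  θ≡3 = coverByColours block (from-yes (all? λ i → clique? (G i) (block i)))
                             (from-yes (all? λ v → any? λ i → v ∈? block i))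
      , at-least-3
    where
    at-least-3 : ∀ m → StrongCover colouring m → 3 ≤ m
    at-least-3 0 = ⊥-elim ∘ from-no (strongCover₀? colouring)
    at-least-3 1 = ⊥-elim ∘ from-no (strongCover₁? colouring)
    at-least-3 2 = ⊥-elim ∘ from-no (strongCover₂? colouring)
    at-least-3 (suc (suc (suc _))) _ = s≤s (s≤s (s≤s z≤n))

theorem1p6 : ((n : ℕ) (c : Coloring 3 n) → IsTK c 3 → (∀ i → Chordal (graph c i))
               → Σ ℕ λ m → IsTheta c m × m ≤ 3)
             × (Σ (Coloring 3 9) λ c → IsTK c 3 × (∀ i → IsInterval (graph c i)) × IsTheta c 3)
theorem1p6 = chordal-θ≤3 , K₉.colouring , K₉.isTK , K₉.isInterval , K₉.θ≡3
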